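{- Let $m,n\ge 1$ and let $\lambda=n^m$ be the rectangular shape with $m$ rows, each of length $n$. Let $\rho=\{\rho_{i,j}\}_{1\le i\le m,\,1\le j\le n}$ be any density on $\lambda$, and define the rotated density $r(\rho)$ by $r(\rho)_{i,j}=\rho_{m-i+1,\,n-j+1}$. Then $\lvert \mathrm{SVT}(\lambda,\rho)\rvert=\lvert \mathrm{SVT}(\lambda,r(\rho))\rvert$.
   Context: A Young diagram of shape $\lambda$ is a left-justified array of cells; the cell in row $i$ and column $j$ is at position $(i,j)$. A density on $\lambda$ is a collection $\rho=\{\rho_{i,j}\}$ of positive integers, one for each cell; let $N=\sum_{i,j}\rho_{i,j}$. A standard set-valued Young tableau of shape $\lambda$ and density $\rho$ is an assignment to each cell $(i,j)$ of a set of exactly $\rho_{i,j}$ integers, these sets partitioning $[N]=\{1,\dots,N\}$, such that every integer in cell $(i,j)$ is smaller than every integer in cell $(i,j+1)$ and every integer in cell $(i+1,j)$ (whenever those cells exist). $\mathrm{SVT}(\lambda,\rho)$ denotes the set of all such tableaux. -}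

module Defs where

open import Data.Nat using (ℕ; zero; suc; _≡ᵇ_; _<ᵇ_)
open import Data.Fin using (Fin; toℕ; opposite)
open import Data.Bool using (Bool; true; false; _∧_; _∨_; not; if_then_else_)
open import Data.Product using (_×_; _,_; proj₁; proj₂)
open import Data.List using (List; []; _∷_; map; allFin; cartesianProduct; concatMap; filterᵇ; length)
open import Data.Bool.ListAction using (and)
open import Data.Nat.ListAction using (sum)

all : ∀ {A : Set} → (A → Bool) → List A → Bool
all p xs = and (map p xs)
open import Data.Vec using (Vec; []; _∷_; lookup)

-- A cell (i , j) of the rectangular shape n^m (m rows, n columns), 0-indexed.
Cell : ℕ → ℕ → Set
Cell m n = Fin m × Fin n

cells : (m n : ℕ) → List (Cell m n)
cells m n = cartesianProduct (allFin m) (allFin n)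

-- A density on the rectangle n^m: a natural number for each cell
-- (positivity is imposed as a hypothesis in the statement).
Density : ℕ → ℕ → Set
Density m n = Fin m → Fin n → ℕ

total : ∀ {m n} → Density m n → ℕ
total {m} {n} ρ = sum (map (λ c → ρ (proj₁ c) (proj₂ c)) (cells m n))

-- Rotated density: r(ρ)_{i,j} = ρ_{m-i+1, n-j+1}  (0-indexed: opposite).
rot : ∀ {m n} → Density m n → Density m n
rot ρ i j = ρ (opposite i) (opposite j)

cellEq : ∀ {m n} → Cell m n → Cell m n → Bool
cellEq (i , j) (i' , j') = (toℕ i ≡ᵇ toℕ i') ∧ (toℕ j ≡ᵇ toℕ j')

nextTo : ∀ {m n} → Cell m n → Cell m n → Bool
nextTo (i , j) (i' , j') =
  ((toℕ i ≡ᵇ toℕ i') ∧ (suc (toℕ j) ≡ᵇ toℕ j'))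
  ∨ ((suc (toℕ i) ≡ᵇ toℕ i') ∧ (toℕ j ≡ᵇ toℕ j'))

-- A set-valued filling with N entries is encoded by the map w : [N] → cells
-- sending each integer k ∈ {0,…,N-1} (standing for k+1 ∈ [N]) to the cell
-- whose set contains it; the sets then partition [N] automatically.
-- It is a standard set-valued Young tableau of density ρ iff
--  * each cell c receives exactly ρ c integers, and
--  * whenever w l is the right or lower neighbour of w k, we have k < l
--    (every entry of a cell is smaller than every entry of the cell to its
--    right and of the cell below it).
countIn : ∀ {m n N} → Vec (Cell m n) N → Cell m n → ℕ
countIn {N = N} w c = length (filterᵇ (λ k → cellEq (lookup w k) c) (allFin N))

isSVT : ∀ {m n N} → Density m n → Vec (Cell m n) N → Bool
isSVT {m} {n} {N} ρ w =
  all (λ c → countIn w c ≡ᵇ ρ (proj₁ c) (proj₂ c)) (cells m n)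
  ∧ all (λ k → all (λ l → not (nextTo (lookup w k) (lookup w l)) ∨ (toℕ k <ᵇ toℕ l))
                   (allFin N))
        (allFin N)

allVecs : ∀ {A : Set} → List A → (N : ℕ) → List (Vec A N)
allVecs xs zero    = [] ∷ []
allVecs xs (suc N) = concatMap (λ x → map (x ∷_) (allVecs xs N)) xs

numSVT : ∀ {m n} → Density m n → ℕ
numSVT {m} {n} ρ = length (filterᵇ (isSVT ρ) (allVecs (cells m n) (total ρ)))

module Submission where

-- Rotating the rectangle by
-- 180 degrees and reading the word backwards,
--     rotateWord w = reverse (map rotateCell w),   (rotateWord w)_k = rot(w_{N-1-k}),
-- turns an SVT of density ρ into an SVT of density rot ρ: the number of
-- entries in cell c becomes the number in rot c, and "w_l is right of/below
-- w_k ⇒ k < l" is carried to itself with k, l exchanged and complemented.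

open import Defs
open import Data.Nat using (ℕ; _≤_)
open import Data.Fin using (Fin)
open import Relation.Binary.PropositionalEquality using (_≡_)

open import Data.Nat using (zero; suc; pred; _+_; _<_; _≡ᵇ_; _<ᵇ_; _≤?_)
open import Data.Nat.Properties
  using (+-assoc; +-comm; +-suc; +-cancelˡ-≡; +-mono-<-≤; <-irrefl; ≰⇒>;
         m∸n+n≡m; ≡ᵇ⇒≡; ≡⇒≡ᵇ; <ᵇ⇒<; <⇒<ᵇ)
open import Data.Nat.Properties using (+-commutativeSemigroup)
open import Algebra.Properties.CommutativeSemigroup +-commutativeSemigroup using () renaming (interchange to +-interchange)
open import Data.Nat.ListAction using (sum)
open import Data.Fin using (toℕ; opposite; fromℕ; inject₁) renaming (zero to fzero; suc to fsuc)
open import Data.Fin.Properties using (opposite-prop; opposite-involutive; toℕ-injective; toℕ≤pred[n])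
open import Data.Bool using (Bool; true; false; _∧_; _∨_; not; if_then_else_; T)
open import Data.Unit using (tt)
open import Data.Empty using (⊥-elim)
open import Data.Product using (_×_; _,_; proj₁; proj₂) renaming (map to ×-map)
open import Data.List using (List; []; _∷_; _++_; map; allFin; cartesianProduct; concatMap; filterᵇ; length)
open import Data.List.Properties using (map-tabulate)
open import Data.List.Membership.Propositional using (_∈_)
open import Data.List.Membership.Propositional.Properties using (∈-allFin; ∈-cartesianProduct⁺)
open import Data.List.Relation.Unary.Any using (here; there)
open import Data.Vec using (Vec; []; _∷_; lookup; reverse; _∷ʳ_) renaming (map to vmap)
open import Data.Vec.Properties using (reverse-∷; lookup-map)
open import Relation.Nullary using (yes; no)
open import Relation.Binary.PropositionalEquality using (refl; sym; trans; cong; cong₂; subst; subst₂; module ≡-Reasoning)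
open import Function using (_∘_)

private
  variable
    A B : Set

sumOver : List A → (A → ℕ) → ℕ
sumOver []       g = 0
sumOver (x ∷ xs) g = g x + sumOver xs g

sumOver-cong : (xs : List A) {g h : A → ℕ} → (∀ x → g x ≡ h x) → sumOver xs g ≡ sumOver xs h
sumOver-cong []       e = refl
sumOver-cong (x ∷ xs) e = cong₂ _+_ (e x) (sumOver-cong xs e)

sum-map : (g : A → ℕ) (xs : List A) → sum (map g xs) ≡ sumOver xs g
sum-map g []       = refl
sum-map g (x ∷ xs) = cong (g x +_) (sum-map g xs)

sumOver-++ : (xs ys : List A) (g : A → ℕ) → sumOver (xs ++ ys) g ≡ sumOver xs g + sumOver ys g
sumOver-++ []       ys g = refl
sumOver-++ (x ∷ xs) ys g = trans (cong (g x +_) (sumOver-++ xs ys g)) (sym (+-assoc (g x) _ _))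

sumOver-map : (f : A → B) (xs : List A) (g : B → ℕ) → sumOver (map f xs) g ≡ sumOver xs (g ∘ f)
sumOver-map f []       g = refl
sumOver-map f (x ∷ xs) g = cong (g (f x) +_) (sumOver-map f xs g)

sumOver-concatMap : (f : A → List B) (xs : List A) (g : B → ℕ) →
  sumOver (concatMap f xs) g ≡ sumOver xs (λ x → sumOver (f x) g)
sumOver-concatMap f []       g = refl
sumOver-concatMap f (x ∷ xs) g =
  trans (sumOver-++ (f x) (concatMap f xs) g) (cong (sumOver (f x) g +_) (sumOver-concatMap f xs g))

sumOver-cartesianProduct : (xs : List A) (ys : List B) (g : A × B → ℕ) →
  sumOver (cartesianProduct xs ys) g ≡ sumOver xs (λ x → sumOver ys (λ y → g (x , y)))
sumOver-cartesianProduct []       ys g = refl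
sumOver-cartesianProduct (x ∷ xs) ys g =
  trans (sumOver-++ (map (x ,_) ys) _ g)
        (cong₂ _+_ (sumOver-map (x ,_) ys g) (sumOver-cartesianProduct xs ys g))

sumOver-+ : (xs : List A) (g h : A → ℕ) → sumOver xs (λ x → g x + h x) ≡ sumOver xs g + sumOver xs h
sumOver-+ []       g h = refl
sumOver-+ (x ∷ xs) g h =
  trans (cong (g x + h x +_) (sumOver-+ xs g h)) (+-interchange (g x) (h x) (sumOver xs g) (sumOver xs h))

sumOver-zero : (xs : List A) → sumOver xs (λ _ → 0) ≡ 0
sumOver-zero []       = refl
sumOver-zero (x ∷ xs) = sumOver-zero xs

-- Fubini: two finite sums commute; used to move the last letter of a word
-- to the outside.
sumOver-swap : (xs : List A) (ys : List B) (g : A → B → ℕ) →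
  sumOver xs (λ x → sumOver ys (g x)) ≡ sumOver ys (λ y → sumOver xs (λ x → g x y))
sumOver-swap []       ys g = sym (sumOver-zero ys)
sumOver-swap (x ∷ xs) ys g =
  trans (cong (sumOver ys (g x) +_) (sumOver-swap xs ys g)) (sym (sumOver-+ ys (g x) _))

indicator : Bool → ℕ
indicator b = if b then 1 else 0

length-filterᵇ : (p : A → Bool) (xs : List A) → length (filterᵇ p xs) ≡ sumOver xs (indicator ∘ p)
length-filterᵇ p []       = refl
length-filterᵇ p (x ∷ xs) with p x
... | true  = cong suc (length-filterᵇ p xs)
... | false = length-filterᵇ p xs

Reindexes : List A → (A → A) → Set
Reindexes xs g = ∀ (h : _ → ℕ) → sumOver xs (h ∘ g) ≡ sumOver xs h

count-cong : {p q : A → Bool} (xs : List A) → (∀ x → p x ≡ q x) →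
  length (filterᵇ p xs) ≡ length (filterᵇ q xs)
count-cong {p = p} {q} xs e = begin
  length (filterᵇ p xs)     ≡⟨ length-filterᵇ p xs ⟩
  sumOver xs (indicator ∘ p) ≡⟨ sumOver-cong xs (cong indicator ∘ e) ⟩
  sumOver xs (indicator ∘ q) ≡⟨ sym (length-filterᵇ q xs) ⟩
  length (filterᵇ q xs)     ∎
  where open ≡-Reasoning

count-reindex : {xs : List A} {g : A → A} → Reindexes xs g → (p : A → Bool) →
  length (filterᵇ (p ∘ g) xs) ≡ length (filterᵇ p xs)
count-reindex {xs = xs} {g} reix p =
  trans (length-filterᵇ (p ∘ g) xs) (trans (reix (indicator ∘ p)) (sym (length-filterᵇ p xs)))

∘-reindexes : {xs : List A} {f g : A → A} → Reindexes xs f → Reindexes xs g → Reindexes xs (f ∘ g)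
∘-reindexes {f = f} reix-f reix-g h = trans (reix-g (h ∘ f)) (reix-f h)

×-reindexes : {xs : List A} {ys : List B} {f : A → A} {g : B → B} →
  Reindexes xs f → Reindexes ys g → Reindexes (cartesianProduct xs ys) (×-map f g)
×-reindexes {xs = xs} {ys} {f} {g} reix-f reix-g h = begin
  sumOver (cartesianProduct xs ys) (h ∘ ×-map f g)   ≡⟨ sumOver-cartesianProduct xs ys _ ⟩
  sumOver xs (λ x → sumOver ys (λ y → h (f x , g y))) ≡⟨ sumOver-cong xs (λ x → reix-g (λ y → h (f x , y))) ⟩
  sumOver xs (λ x → sumOver ys (λ y → h (f x , y)))   ≡⟨ reix-f (λ x → sumOver ys (λ y → h (x , y))) ⟩
  sumOver xs (λ x → sumOver ys (λ y → h (x , y)))     ≡⟨ sym (sumOver-cartesianProduct xs ys h) ⟩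
  sumOver (cartesianProduct xs ys) h                  ∎
  where open ≡-Reasoning

sumOver-allFin-first : ∀ n (g : Fin (suc n) → ℕ) →
  sumOver (allFin (suc n)) g ≡ g fzero + sumOver (allFin n) (g ∘ fsuc)
sumOver-allFin-first n g =
  cong (g fzero +_) (trans (cong (λ xs → sumOver xs g) (sym (map-tabulate (λ i → i) fsuc)))
                           (sumOver-map fsuc (allFin n) g))

sumOver-allFin-last : ∀ n (g : Fin (suc n) → ℕ) →
  sumOver (allFin (suc n)) g ≡ sumOver (allFin n) (g ∘ inject₁) + g (fromℕ n)
sumOver-allFin-last zero    g = +-comm (g fzero) 0
sumOver-allFin-last (suc n) g = begin
  sumOver (allFin (suc (suc n))) g                                 ≡⟨ sumOver-allFin-first (suc n) g ⟩
  g fzero + sumOver (allFin (suc n)) (g ∘ fsuc)                    ≡⟨ cong (g fzero +_) (sumOver-allFin-last n (g ∘ fsuc)) ⟩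
  g fzero + (sumOver (allFin n) (g ∘ fsuc ∘ inject₁) + g (fromℕ (suc n)))
                                                                   ≡⟨ sym (+-assoc (g fzero) _ _) ⟩
  (g fzero + sumOver (allFin n) (g ∘ inject₁ ∘ fsuc)) + g (fromℕ (suc n))
                                                                   ≡⟨ cong (_+ g (fromℕ (suc n))) (sym (sumOver-allFin-first n (g ∘ inject₁))) ⟩
  sumOver (allFin (suc n)) (g ∘ inject₁) + g (fromℕ (suc n))       ∎
  where open ≡-Reasoning

-- Reversing the order of Fin n: the sum picks up the last term first.
opposite-reindexes : ∀ n → Reindexes (allFin n) opposite
opposite-reindexes zero    g = refl
opposite-reindexes (suc n) g = begin
  sumOver (allFin (suc n)) (g ∘ opposite)                   ≡⟨ sumOver-allFin-first n (g ∘ opposite) ⟩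
  g (fromℕ n) + sumOver (allFin n) (g ∘ inject₁ ∘ opposite) ≡⟨ cong (g (fromℕ n) +_) (opposite-reindexes n (g ∘ inject₁)) ⟩
  g (fromℕ n) + sumOver (allFin n) (g ∘ inject₁)            ≡⟨ +-comm (g (fromℕ n)) _ ⟩
  sumOver (allFin n) (g ∘ inject₁) + g (fromℕ n)            ≡⟨ sym (sumOver-allFin-last n g) ⟩
  sumOver (allFin (suc n)) g                                ∎
  where open ≡-Reasoning

sumOver-words-cons : (xs : List A) (N : ℕ) (F : Vec A (suc N) → ℕ) →
  sumOver (allVecs xs (suc N)) F ≡ sumOver xs (λ x → sumOver (allVecs xs N) (F ∘ (x ∷_)))
sumOver-words-cons xs N F =
  trans (sumOver-concatMap (λ x → map (x ∷_) (allVecs xs N)) xs F)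
        (sumOver-cong xs (λ x → sumOver-map (x ∷_) (allVecs xs N) F))

sumOver-words-snoc : (xs : List A) (N : ℕ) (F : Vec A (suc N) → ℕ) →
  sumOver (allVecs xs (suc N)) F ≡ sumOver xs (λ x → sumOver (allVecs xs N) (λ v → F (v ∷ʳ x)))
sumOver-words-snoc xs zero    F = sumOver-words-cons xs zero F
sumOver-words-snoc xs (suc N) F = begin
  sumOver (allVecs xs (suc (suc N))) F
    ≡⟨ sumOver-words-cons xs (suc N) F ⟩
  sumOver xs (λ x → sumOver (allVecs xs (suc N)) (F ∘ (x ∷_)))
    ≡⟨ sumOver-cong xs (λ x → sumOver-words-snoc xs N (F ∘ (x ∷_))) ⟩
  sumOver xs (λ x → sumOver xs (λ y → sumOver (allVecs xs N) (λ v → F (x ∷ (v ∷ʳ y)))))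
    ≡⟨ sumOver-swap xs xs _ ⟩
  sumOver xs (λ y → sumOver xs (λ x → sumOver (allVecs xs N) (λ v → F (x ∷ (v ∷ʳ y)))))
    ≡⟨ sumOver-cong xs (λ y → sym (sumOver-words-cons xs N (λ v → F (v ∷ʳ y)))) ⟩
  sumOver xs (λ y → sumOver (allVecs xs (suc N)) (λ v → F (v ∷ʳ y)))
    ∎
  where open ≡-Reasoning

reverse-reindexes : (xs : List A) (N : ℕ) → Reindexes (allVecs xs N) reverse
reverse-reindexes xs zero    F = refl
reverse-reindexes xs (suc N) F = begin
  sumOver (allVecs xs (suc N)) (F ∘ reverse)
    ≡⟨ sumOver-words-cons xs N (F ∘ reverse) ⟩
  sumOver xs (λ x → sumOver (allVecs xs N) (λ v → F (reverse (x ∷ v))))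
    ≡⟨ sumOver-cong xs (λ x → sumOver-cong (allVecs xs N) (λ v → cong F (reverse-∷ x v))) ⟩
  sumOver xs (λ x → sumOver (allVecs xs N) (λ v → F (reverse v ∷ʳ x)))
    ≡⟨ sumOver-cong xs (λ x → reverse-reindexes xs N (λ v → F (v ∷ʳ x))) ⟩
  sumOver xs (λ x → sumOver (allVecs xs N) (λ v → F (v ∷ʳ x)))
    ≡⟨ sym (sumOver-words-snoc xs N F) ⟩
  sumOver (allVecs xs (suc N)) F
    ∎
  where open ≡-Reasoning

vmap-reindexes : {xs : List A} {g : A → A} → Reindexes xs g → ∀ N → Reindexes (allVecs xs N) (vmap g)
vmap-reindexes reix zero    F = refl
vmap-reindexes {xs = xs} {g} reix (suc N) F = begin
  sumOver (allVecs xs (suc N)) (F ∘ vmap g)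
    ≡⟨ sumOver-words-cons xs N (F ∘ vmap g) ⟩
  sumOver xs (λ x → sumOver (allVecs xs N) (λ v → F (g x ∷ vmap g v)))
    ≡⟨ sumOver-cong xs (λ x → vmap-reindexes reix N (λ v → F (g x ∷ v))) ⟩
  sumOver xs (λ x → sumOver (allVecs xs N) (λ v → F (g x ∷ v)))
    ≡⟨ reix (λ y → sumOver (allVecs xs N) (λ v → F (y ∷ v))) ⟩
  sumOver xs (λ y → sumOver (allVecs xs N) (F ∘ (y ∷_)))
    ≡⟨ sym (sumOver-words-cons xs N F) ⟩
  sumOver (allVecs xs (suc N)) F
    ∎
  where open ≡-Reasoning

lookup-∷ʳ-inject₁ : ∀ {n} (u : Vec A n) x (k : Fin n) → lookup (u ∷ʳ x) (inject₁ k) ≡ lookup u k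
lookup-∷ʳ-inject₁ (y ∷ u) x fzero    = refl
lookup-∷ʳ-inject₁ (y ∷ u) x (fsuc k) = lookup-∷ʳ-inject₁ u x k

lookup-∷ʳ-last : ∀ {n} (u : Vec A n) x → lookup (u ∷ʳ x) (fromℕ n) ≡ x
lookup-∷ʳ-last []      x = refl
lookup-∷ʳ-last (y ∷ u) x = lookup-∷ʳ-last u x

lookup-reverse-opposite : ∀ {n} (v : Vec A n) (k : Fin n) → lookup (reverse v) (opposite k) ≡ lookup v k
lookup-reverse-opposite {n = suc n} (x ∷ v) fzero =
  trans (cong (λ u → lookup u (fromℕ n)) (reverse-∷ x v)) (lookup-∷ʳ-last (reverse v) x)
lookup-reverse-opposite (x ∷ v) (fsuc k) =
  trans (cong (λ u → lookup u (inject₁ (opposite k))) (reverse-∷ x v))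
        (trans (lookup-∷ʳ-inject₁ (reverse v) x (opposite k)) (lookup-reverse-opposite v k))

lookup-reverse : ∀ {n} (v : Vec A n) (k : Fin n) → lookup (reverse v) k ≡ lookup v (opposite k)
lookup-reverse v k =
  trans (cong (lookup (reverse v)) (sym (opposite-involutive k))) (lookup-reverse-opposite v (opposite k))

T-ext : {b c : Bool} → (T b → T c) → (T c → T b) → b ≡ c
T-ext {false} {false} _ _ = refl
T-ext {false} {true}  _ g = ⊥-elim (g tt)
T-ext {true}  {false} f _ = ⊥-elim (f tt)
T-ext {true}  {true}  _ _ = refl

all-cong : {p q : A → Bool} (xs : List A) → (∀ x → p x ≡ q x) → all p xs ≡ all q xs
all-cong []       e = refl
all-cong (x ∷ xs) e = cong₂ _∧_ (e x) (all-cong xs e)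

all-elim : (p : A → Bool) {xs : List A} → T (all p xs) → ∀ {x} → x ∈ xs → T (p x)
all-elim p {y ∷ xs} t (here refl) with p y | t
... | true | _ = tt
all-elim p {y ∷ xs} t (there x∈xs) with p y | t
... | true | t′ = all-elim p t′ x∈xs

all-intro : (p : A → Bool) (xs : List A) → (∀ x → T (p x)) → T (all p xs)
all-intro p []       h = tt
all-intro p (y ∷ xs) h with p y | h y
... | true | _ = all-intro p xs h

Complete : List A → Set
Complete xs = ∀ x → x ∈ xs

cells-complete : ∀ m n → Complete (cells m n)
cells-complete m n (i , j) = ∈-cartesianProduct⁺ (∈-allFin i) (∈-allFin j)

all-involution : {xs : List A} → Complete xs → {g : A → A} → (∀ x → g (g x) ≡ x) →
  (p : A → Bool) → all (p ∘ g) xs ≡ all p xs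
all-involution {xs = xs} complete {g} invol p = T-ext
  (λ t → all-intro p xs (λ x → subst (T ∘ p) (invol x) (all-elim (p ∘ g) t (complete (g x)))))
  (λ t → all-intro (p ∘ g) xs (λ x → all-elim p t (complete (g x))))

all²-involution : {A : Set} {xs : List A} → Complete xs → {g : A → A} → (∀ x → g (g x) ≡ x) →
  (q : A → A → Bool) →
  all (λ k → all (λ l → q (g l) (g k)) xs) xs ≡ all (λ k → all (q k) xs) xs
all²-involution {A} {xs} complete {g} invol q = T-ext
  (λ t → intro² q (λ k l → subst₂ (λ a b → T (q a b)) (invol k) (invol l) (elim² _ t (g l) (g k))))
  (λ t → intro² _ (λ k l → elim² q t (g l) (g k)))
  where
  elim² : (r : A → A → Bool) → T (all (λ k → all (r k) xs) xs) → ∀ k l → T (r k l)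
  elim² r t k l = all-elim (r k) (all-elim _ t (complete k)) (complete l)
  intro² : (r : A → A → Bool) → (∀ k l → T (r k l)) → T (all (λ k → all (r k) xs) xs)
  intro² r h = all-intro _ xs (λ k → all-intro (r k) xs (h k))

-- If a' + a and b' + b have the same value, comparing a' with b' is comparing
-- b with a.  Applied to a' = toℕ (opposite x), a = toℕ x.
module Complement {a a′ b b′ s : ℕ} (ea : a′ + a ≡ s) (eb : b′ + b ≡ s) where

  ≡-complement : a′ ≡ b′ → b ≡ a
  ≡-complement refl = sym (+-cancelˡ-≡ a′ a b (trans ea (sym eb)))

  suc-complement : suc a′ ≡ b′ → suc b ≡ a
  suc-complement refl = sym (+-cancelˡ-≡ a′ a (suc b) (trans ea (trans (sym eb) (sym (+-suc a′ b)))))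

  <-complement : a′ < b′ → b < a
  <-complement a′<b′ with a ≤? b
  ... | yes a≤b = ⊥-elim (<-irrefl (trans ea (sym eb)) (+-mono-<-≤ a′<b′ a≤b))
  ... | no  a≰b = ≰⇒> a≰b

-- The Boolean forms; the converse directions swap the roles of the two pairs.
module ComplementBool {a a′ b b′ s : ℕ} (ea : a′ + a ≡ s) (eb : b′ + b ≡ s) where
  private
    module To   = Complement {a} {a′} {b} {b′} ea eb
    module From = Complement {b′} {b} {a′} {a} (trans (+-comm b b′) eb) (trans (+-comm a a′) ea)

  ≡ᵇ-complement : (a′ ≡ᵇ b′) ≡ (b ≡ᵇ a)
  ≡ᵇ-complement = T-ext
    (λ t → ≡⇒≡ᵇ b a (To.≡-complement (≡ᵇ⇒≡ a′ b′ t)))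
    (λ t → ≡⇒≡ᵇ a′ b′ (From.≡-complement (≡ᵇ⇒≡ b a t)))

  sucᵇ-complement : (suc a′ ≡ᵇ b′) ≡ (suc b ≡ᵇ a)
  sucᵇ-complement = T-ext
    (λ t → ≡⇒≡ᵇ (suc b) a (To.suc-complement (≡ᵇ⇒≡ (suc a′) b′ t)))
    (λ t → ≡⇒≡ᵇ (suc a′) b′ (From.suc-complement (≡ᵇ⇒≡ (suc b) a t)))

  <ᵇ-complement : (a′ <ᵇ b′) ≡ (b <ᵇ a)
  <ᵇ-complement = T-ext
    (λ t → <⇒<ᵇ (To.<-complement (<ᵇ⇒< a′ b′ t)))
    (λ t → <⇒<ᵇ (From.<-complement (<ᵇ⇒< b a t)))

opposite-sum : ∀ {n} (x : Fin n) → toℕ (opposite x) + toℕ x ≡ pred n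
opposite-sum {suc n} x = trans (cong (_+ toℕ x) (opposite-prop x)) (m∸n+n≡m (toℕ≤pred[n] x))

module OppositeBool {n} (x y : Fin n) =
  ComplementBool {toℕ x} {toℕ (opposite x)} {toℕ y} {toℕ (opposite y)} (opposite-sum x) (opposite-sum y)

≡ᵇ-opposite : ∀ {n} (x y : Fin n) → (toℕ (opposite x) ≡ᵇ toℕ y) ≡ (toℕ x ≡ᵇ toℕ (opposite y))
≡ᵇ-opposite x y = T-ext
  (λ t → ≡⇒≡ᵇ _ _ (cong toℕ (trans (sym (opposite-involutive x)) (cong opposite (fromᵇ t)))))
  (λ t → ≡⇒≡ᵇ _ _ (cong toℕ (trans (cong opposite (fromᵇ t)) (opposite-involutive y))))
  where
  fromᵇ : ∀ {n} {u v : Fin n} → T (toℕ u ≡ᵇ toℕ v) → u ≡ v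
  fromᵇ {u = u} {v} t = toℕ-injective (≡ᵇ⇒≡ (toℕ u) (toℕ v) t)

rotateCell : ∀ {m n} → Cell m n → Cell m n
rotateCell = ×-map opposite opposite

rotateCell-involutive : ∀ {m n} (c : Cell m n) → rotateCell (rotateCell c) ≡ c
rotateCell-involutive (i , j) = cong₂ _,_ (opposite-involutive i) (opposite-involutive j)

rotateCell-reindexes : ∀ m n → Reindexes (cells m n) rotateCell
rotateCell-reindexes m n =
  ×-reindexes {xs = allFin m} {ys = allFin n} {f = opposite} {g = opposite}
    (opposite-reindexes m) (opposite-reindexes n)

cellEq-rotate : ∀ {m n} (c d : Cell m n) → cellEq (rotateCell c) d ≡ cellEq c (rotateCell d)
cellEq-rotate (i , j) (i′ , j′) = cong₂ _∧_ (≡ᵇ-opposite i i′) (≡ᵇ-opposite j j′)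

nextTo-rotate : ∀ {m n} (c d : Cell m n) → nextTo (rotateCell c) (rotateCell d) ≡ nextTo d c
nextTo-rotate (i , j) (i′ , j′) =
  cong₂ _∨_ (cong₂ _∧_ (OppositeBool.≡ᵇ-complement i i′) (OppositeBool.sucᵇ-complement j j′))
            (cong₂ _∧_ (OppositeBool.sucᵇ-complement i i′) (OppositeBool.≡ᵇ-complement j j′))

total-rot : ∀ {m n} (ρ : Density m n) → total (rot ρ) ≡ total ρ
total-rot {m} {n} ρ = begin
  sum (map (ρ′ ∘ rotateCell) (cells m n)) ≡⟨ sum-map (ρ′ ∘ rotateCell) (cells m n) ⟩
  sumOver (cells m n) (ρ′ ∘ rotateCell)   ≡⟨ rotateCell-reindexes m n ρ′ ⟩
  sumOver (cells m n) ρ′                  ≡⟨ sym (sum-map ρ′ (cells m n)) ⟩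
  sum (map ρ′ (cells m n))                ∎
  where
  open ≡-Reasoning
  ρ′ : Cell m n → ℕ
  ρ′ c = ρ (proj₁ c) (proj₂ c)

rotateWord : ∀ {m n N} → Vec (Cell m n) N → Vec (Cell m n) N
rotateWord w = reverse (vmap rotateCell w)

lookup-rotateWord : ∀ {m n N} (w : Vec (Cell m n) N) (k : Fin N) →
  lookup (rotateWord w) k ≡ rotateCell (lookup w (opposite k))
lookup-rotateWord w k = trans (lookup-reverse (vmap rotateCell w) k) (lookup-map (opposite k) rotateCell w)

rotateWord-reindexes : ∀ m n N → Reindexes (allVecs (cells m n) N) rotateWord
rotateWord-reindexes m n N =
  ∘-reindexes {xs = allVecs (cells m n) N} {f = reverse} {g = vmap rotateCell}
    (reverse-reindexes (cells m n) N) (vmap-reindexes {xs = cells m n} (rotateCell-reindexes m n) N)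

countIn-rotateWord : ∀ {m n N} (w : Vec (Cell m n) N) (c : Cell m n) →
  countIn (rotateWord w) c ≡ countIn w (rotateCell c)
countIn-rotateWord {N = N} w c = begin
  length (filterᵇ (λ k → cellEq (lookup (rotateWord w) k) c) (allFin N))
    ≡⟨ length-filterᵇ _ (allFin N) ⟩
  sumOver (allFin N) (λ k → indicator (cellEq (lookup (rotateWord w) k) c))
    ≡⟨ sumOver-cong (allFin N) (λ k → cong indicator (pointwise k)) ⟩
  sumOver (allFin N) (λ k → indicator (cellEq (lookup w (opposite k)) (rotateCell c)))
    ≡⟨ opposite-reindexes N (λ k → indicator (cellEq (lookup w k) (rotateCell c))) ⟩
  sumOver (allFin N) (λ k → indicator (cellEq (lookup w k) (rotateCell c)))
    ≡⟨ sym (length-filterᵇ _ (allFin N)) ⟩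
  length (filterᵇ (λ k → cellEq (lookup w k) (rotateCell c)) (allFin N))
    ∎
  where
  open ≡-Reasoning
  pointwise : ∀ k → cellEq (lookup (rotateWord w) k) c ≡ cellEq (lookup w (opposite k)) (rotateCell c)
  pointwise k = trans (cong (λ d → cellEq d c) (lookup-rotateWord w k)) (cellEq-rotate _ c)

ordered : ∀ {m n N} → Vec (Cell m n) N → Fin N → Fin N → Bool
ordered w k l = not (nextTo (lookup w k) (lookup w l)) ∨ (toℕ k <ᵇ toℕ l)

ordered-rotateWord : ∀ {m n N} (w : Vec (Cell m n) N) (k l : Fin N) →
  ordered (rotateWord w) k l ≡ ordered w (opposite l) (opposite k)
ordered-rotateWord w k l = cong₂ _∨_
  (cong not (trans (cong₂ nextTo (lookup-rotateWord w k) (lookup-rotateWord w l))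
                   (nextTo-rotate (lookup w (opposite k)) (lookup w (opposite l)))))
  (sym (OppositeBool.<ᵇ-complement l k))

isSVT-rotate : ∀ {m n N} (ρ : Density m n) (w : Vec (Cell m n) N) →
  isSVT (rot ρ) (rotateWord w) ≡ isSVT ρ w
isSVT-rotate {m} {n} {N} ρ w = cong₂ _∧_ densities orders
  where
  hasDensity : Cell m n → Bool
  hasDensity c = countIn w c ≡ᵇ ρ (proj₁ c) (proj₂ c)
  densities : all (λ c → countIn (rotateWord w) c ≡ᵇ rot ρ (proj₁ c) (proj₂ c)) (cells m n)
            ≡ all hasDensity (cells m n)
  densities = trans
    (all-cong (cells m n) (λ c → cong (_≡ᵇ rot ρ (proj₁ c) (proj₂ c)) (countIn-rotateWord w c)))
    (all-involution (cells-complete m n) rotateCell-involutive hasDensity)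
  orders : all (λ k → all (ordered (rotateWord w) k) (allFin N)) (allFin N)
         ≡ all (λ k → all (ordered w k) (allFin N)) (allFin N)
  orders = trans
    (all-cong (allFin N) (λ k → all-cong (allFin N) (ordered-rotateWord w k)))
    (all²-involution ∈-allFin opposite-involutive (ordered w))

proposition1p1 : (m n : ℕ) → 1 ≤ m → 1 ≤ n → (ρ : Density m n) →
    (∀ (i : Fin m) (j : Fin n) → 1 ≤ ρ i j) →
    numSVT ρ ≡ numSVT (rot ρ)
proposition1p1 m n _ _ ρ _ = begin
  numSVT ρ
    ≡⟨ count-cong words (λ w → sym (isSVT-rotate ρ w)) ⟩
  length (filterᵇ (isSVT (rot ρ) ∘ rotateWord) words)
    ≡⟨ count-reindex {xs = words} {g = rotateWord} (rotateWord-reindexes m n (total ρ)) (isSVT (rot ρ)) ⟩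
  length (filterᵇ (isSVT (rot ρ)) words)
    ≡⟨ cong (λ N → length (filterᵇ (isSVT (rot ρ)) (allVecs (cells m n) N))) (sym (total-rot ρ)) ⟩
  numSVT (rot ρ)
    ∎
  where
  open ≡-Reasoning
  words : List (Vec (Cell m n) (total ρ))
  words = allVecs (cells m n) (total ρ)
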